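{- Let $A$ be a set partition of $\{1,\dots,n\}$. Then for each $v\in\{1,\dots,n\}$, \[ \mathtt{t}_v(A)+\mathtt{i}_v(A)=v-1, \] where $\mathtt{t}_v(A)$ is the partial depth index and $\mathtt{i}_v(A)$ is the partial intertwining number of $v$.
   Context: Arcs of $A$: pairs $(i,j)$, $i<j$, of elements in the same block with no element of that block strictly between them. Extended arc diagram: in addition to the arcs, it has a half-arc $(-\infty,i)$ for each block minimum $i$ and a half-arc $(i,\infty)$ for each block maximum $i$. Two (generalized) arcs $(i,j),(k,\ell)$ cross if $i<k<j<\ell$. Partner of $v$: the partner $u$ of $v$ is $0$ if $v$ is the minimum of its block. Otherwise it is the largest element of the block of $v$ smaller than $v$, so that $(u,v)$ is an arc. Partial intertwining number $\mathtt{i}_v(A)$: the number of crossings of the arc or half-arc ending in $v$ with arcs or half-arcs whose smaller vertex $i$ satisfies $u<i<v$. The arc ending in $v$ is $(u,v)$, or the half-arc $(-\infty,v)$ if $v$ is a block minimum. Concretely, $\mathtt{i}_v(A)$ is the number of arcs or right half-arcs $(i,j)$ (with $j$ possibly $\infty$) such that $u<i<v<j$. Partial depth index: $\mathtt{t}_v(A)=u+\#\{\text{arcs }(i,j)\text{ of }A: u<i<j<v\}$. -}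

module Defs where

open import Data.Bool using (Bool; true; false; _∧_; not)
open import Data.Nat using (ℕ; zero; suc; _+_; _⊔_; _≡ᵇ_; _<ᵇ_)
open import Data.List using (List; map; upTo; filterᵇ; length; foldr; cartesianProduct)
open import Data.Bool.ListAction using (all; any)
open import Data.Product using (_×_; _,_)

-- A set partition of {1,…,n} is given by a block labelling  L : ℕ → ℕ :
-- x and y (both in {1,…,n}) lie in the same block iff  L x ≡ L y .
-- Every set partition arises this way (label each element by, e.g., its block
-- minimum) and every labelling induces one; values of L outside {1,…,n} are
-- never consulted.

elems : ℕ → List ℕ
elems n = map suc (upTo n)

sameBlock : (ℕ → ℕ) → ℕ → ℕ → Bool
sameBlock L x y = L x ≡ᵇ L y

between : ℕ → ℕ → ℕ → Bool
between a b c = (a <ᵇ b) ∧ (b <ᵇ c)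

isArc : ℕ → (ℕ → ℕ) → ℕ → ℕ → Bool
isArc n L i j =
  any (λ x → x ≡ᵇ i) (elems n) ∧ any (λ x → x ≡ᵇ j) (elems n) ∧ (i <ᵇ j)
  ∧ sameBlock L i j
  ∧ all (λ k → not (between i k j ∧ sameBlock L i k)) (elems n)

arcs : ℕ → (ℕ → ℕ) → List (ℕ × ℕ)
arcs n L = filterᵇ (λ { (i , j) → isArc n L i j }) (cartesianProduct (elems n) (elems n))

-- i is the maximum of its block (i.e. carries a right half-arc (i , ∞))
isBlockMax : ℕ → (ℕ → ℕ) → ℕ → Bool
isBlockMax n L i = all (λ k → not ((i <ᵇ k) ∧ sameBlock L i k)) (elems n)

-- partner of v: largest element of the block of v smaller than v, or 0 if none
partner : ℕ → (ℕ → ℕ) → ℕ → ℕ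
partner n L v = foldr _⊔_ 0 (filterᵇ (λ k → (k <ᵇ v) ∧ sameBlock L k v) (elems n))

intertwining : ℕ → (ℕ → ℕ) → ℕ → ℕ
intertwining n L v =
  length (filterᵇ (λ { (i , j) → between (partner n L v) i v ∧ (v <ᵇ j) }) (arcs n L))
  + length (filterᵇ (λ i → between (partner n L v) i v ∧ isBlockMax n L i) (elems n))

depthIndex : ℕ → (ℕ → ℕ) → ℕ → ℕ
depthIndex n L v =
  partner n L v
  + length (filterᵇ (λ { (i , j) → between (partner n L v) i j ∧ (j <ᵇ v) }) (arcs n L))

module Submission where

open import Defs
open import Data.Nat using (ℕ; _+_; _∸_; _≤_)
open import Relation.Binary.PropositionalEquality using (_≡_)

-- Every i ∈ {1,…,n} is the left end of exactly one generalized arc: the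
-- arc to the next element of its block, or the half-arc (i , ∞) when i is
-- a block maximum.  Both t_v - u and i_v count generalized arcs by their
-- left end i, and only left ends with u < i < v occur.  The generalized
-- arc leaving such an i cannot end in v (i would be an element of v's
-- block between u and v), so it ends either before v (counted by t_v) or
-- after v (counted by i_v).  Hence t_v + i_v = u + #{i : u < i < v} = v - 1.

open import Data.Nat using (zero; suc; _<_; _⊓_; _⊔_; _≡ᵇ_; _<ᵇ_; z≤n; z<s)
open import Data.Nat.Properties
open import Algebra.Properties.CommutativeSemigroup Data.Nat.Properties.+-commutativeSemigroup
  using (interchange)
open import Data.Bool using (Bool; true; false; _∧_; not; T)
open import Data.Bool.Properties using (T-∧)
open import Data.Bool.ListAction using (all; any)
open import Data.List using (List; []; _∷_; _++_; map; upTo; filterᵇ; length; foldr; cartesianProduct)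
open import Data.List.Properties using (upTo-∷ʳ; map-++)
open import Data.List.Membership.Propositional using (_∈_)
open import Data.List.Membership.Propositional.Properties using (∈-map⁺; ∈-map⁻; ∈-upTo⁺; ∈-upTo⁻; ∈-filter⁺)
open import Data.List.Relation.Unary.Any as Any using (here; there)
open import Data.List.Relation.Unary.Any.Properties using (any⁺)
open import Data.List.Relation.Unary.All as All using (All; []; _∷_)
open import Data.List.Relation.Unary.All.Properties using (all⁺; all⁻; all-filter)
open import Data.Product using (_×_; _,_; proj₁; proj₂; ∃-syntax)
open import Data.Sum using (_⊎_; inj₁; inj₂)
open import Data.Empty using (⊥-elim)
open import Function using (_∘_)
open import Function.Bundles using (Equivalence; _⇔_; mk⇔)
open Equivalence using (to; from)
open import Relation.Nullary using (¬_; yes; no)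
open import Relation.Nullary.Decidable using (T?; _×-dec_)
open import Relation.Unary using (Decidable)
open import Relation.Binary.Definitions using (tri<; tri≈; tri>)
open import Relation.Binary.PropositionalEquality using (_≢_; refl; sym; trans; cong; cong₂; module ≡-Reasoning)

open ≡-Reasoning

-- Booleans as propositions: conjunction, negation and `between` under T.
-- The first conjunct of T-∧⁻ is explicit because `T (a ∧ b)` does not
-- determine `a` by unification.

T-∧⁻ : ∀ a {b} → T (a ∧ b) → T a × T b
T-∧⁻ a = to (T-∧ {a})

T-∧⁺ : ∀ {a b} → T a → T b → T (a ∧ b)
T-∧⁺ ta tb = from T-∧ (ta , tb)

T-not⁻ : ∀ b → T (not b) → ¬ T b
T-not⁻ true ()
T-not⁻ false _ ()

T-not⁺ : ∀ {b} → ¬ T b → T (not b)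
T-not⁺ {true} ¬tb = ¬tb _
T-not⁺ {false} _ = _

between⁺ : ∀ {a b c} → a < b → b < c → T (between a b c)
between⁺ a<b b<c = T-∧⁺ (<⇒<ᵇ a<b) (<⇒<ᵇ b<c)

between⁻ : ∀ a b c → T (between a b c) → a < b × b < c
between⁻ a b c t with T-∧⁻ (a <ᵇ b) t
... | tab , tbc = <ᵇ⇒< a b tab , <ᵇ⇒< b c tbc

[_] : Bool → ℕ
[ true ] = 1
[ false ] = 0

[]-true : ∀ {b} → T b → [ b ] ≡ 1
[]-true {true} _ = refl

[]-false : ∀ {b} → ¬ T b → [ b ] ≡ 0
[]-false {true} ¬tb = ⊥-elim (¬tb _)
[]-false {false} _ = refl

[]-cong : ∀ {a b} → (T a → T b) → (T b → T a) → [ a ] ≡ [ b ]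
[]-cong {true} {true} _ _ = refl
[]-cong {true} {false} a⇒b _ = ⊥-elim (a⇒b _)
[]-cong {false} {true} _ b⇒a = ⊥-elim (b⇒a _)
[]-cong {false} {false} _ _ = refl

[]-∧-true : ∀ a {b} → T a → [ a ∧ b ] ≡ [ b ]
[]-∧-true true _ = refl

[<]+[>]≡1 : ∀ {j v} → j ≢ v → [ j <ᵇ v ] + [ v <ᵇ j ] ≡ 1
[<]+[>]≡1 {j} {v} j≢v with <-cmp j v
... | tri< j<v _ v≮j = cong₂ _+_ ([]-true (<⇒<ᵇ j<v)) ([]-false (v≮j ∘ <ᵇ⇒< v j))
... | tri≈ _ j≡v _ = ⊥-elim (j≢v j≡v)
... | tri> j≮v _ v<j = cong₂ _+_ ([]-false (j≮v ∘ <ᵇ⇒< j v)) ([]-true (<⇒<ᵇ v<j))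

∑ : {X : Set} → (X → ℕ) → List X → ℕ
∑ f [] = 0
∑ f (x ∷ xs) = f x + ∑ f xs

∑-++ : {X : Set} (f : X → ℕ) (xs ys : List X) → ∑ f (xs ++ ys) ≡ ∑ f xs + ∑ f ys
∑-++ f [] ys = refl
∑-++ f (x ∷ xs) ys = trans (cong (f x +_) (∑-++ f xs ys)) (sym (+-assoc (f x) _ _))

∑-map : {X Y : Set} (f : Y → ℕ) (h : X → Y) (xs : List X) → ∑ f (map h xs) ≡ ∑ (f ∘ h) xs
∑-map f h [] = refl
∑-map f h (x ∷ xs) = cong (f (h x) +_) (∑-map f h xs)

∑-+ : {X : Set} (f g : X → ℕ) (xs : List X) → ∑ f xs + ∑ g xs ≡ ∑ (λ x → f x + g x) xs
∑-+ f g [] = refl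
∑-+ f g (x ∷ xs) =
  trans (interchange (f x) (∑ f xs) (g x) (∑ g xs)) (cong (f x + g x +_) (∑-+ f g xs))

∑-cong : {X : Set} {f g : X → ℕ} (xs : List X) → (∀ {x} → x ∈ xs → f x ≡ g x) → ∑ f xs ≡ ∑ g xs
∑-cong [] _ = refl
∑-cong (x ∷ xs) f≗g = cong₂ _+_ (f≗g (here refl)) (∑-cong xs (f≗g ∘ there))

∑-zero : {X : Set} {f : X → ℕ} (xs : List X) → (∀ {x} → x ∈ xs → f x ≡ 0) → ∑ f xs ≡ 0
∑-zero [] _ = refl
∑-zero (x ∷ xs) f≗0 = cong₂ _+_ (f≗0 (here refl)) (∑-zero xs (f≗0 ∘ there))

∑-cartesianProduct : {X Y : Set} (g : X × Y → ℕ) (xs : List X) (ys : List Y) →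
  ∑ g (cartesianProduct xs ys) ≡ ∑ (λ x → ∑ (λ y → g (x , y)) ys) xs
∑-cartesianProduct g [] ys = refl
∑-cartesianProduct g (x ∷ xs) ys =
  trans (∑-++ g (map (x ,_) ys) _) (cong₂ _+_ (∑-map g (x ,_) ys) (∑-cartesianProduct g xs ys))

length-filterᵇ : {X : Set} (p : X → Bool) (xs : List X) → length (filterᵇ p xs) ≡ ∑ (λ x → [ p x ]) xs
length-filterᵇ p [] = refl
length-filterᵇ p (x ∷ xs) with p x
... | true = cong suc (length-filterᵇ p xs)
... | false = length-filterᵇ p xs

∑-filterᵇ : {X : Set} (p q : X → Bool) (xs : List X) →
  ∑ (λ x → [ p x ]) (filterᵇ q xs) ≡ ∑ (λ x → [ q x ∧ p x ]) xs
∑-filterᵇ p q [] = refl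
∑-filterᵇ p q (x ∷ xs) with q x
... | true = cong ([ p x ] +_) (∑-filterᵇ p q xs)
... | false = ∑-filterᵇ p q xs

count-pairs : {X Y : Set} (p q : X × Y → Bool) (xs : List X) (ys : List Y) →
  length (filterᵇ p (filterᵇ q (cartesianProduct xs ys)))
    ≡ ∑ (λ x → ∑ (λ y → [ q (x , y) ∧ p (x , y) ]) ys) xs
count-pairs p q xs ys = begin
  length (filterᵇ p (filterᵇ q (cartesianProduct xs ys)))
    ≡⟨ length-filterᵇ p (filterᵇ q (cartesianProduct xs ys)) ⟩
  ∑ (λ z → [ p z ]) (filterᵇ q (cartesianProduct xs ys))
    ≡⟨ ∑-filterᵇ p q (cartesianProduct xs ys) ⟩
  ∑ (λ z → [ q z ∧ p z ]) (cartesianProduct xs ys)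
    ≡⟨ ∑-cartesianProduct _ xs ys ⟩
  ∑ (λ x → ∑ (λ y → [ q (x , y) ∧ p (x , y) ]) ys) xs ∎

elems-suc : ∀ n → elems (suc n) ≡ elems n ++ suc n ∷ []
elems-suc n = trans (cong (map suc) (sym (upTo-∷ʳ n))) (map-++ suc (upTo n) (n ∷ []))

∈-elems⁺ : ∀ {n x} → 0 < x → x ≤ n → x ∈ elems n
∈-elems⁺ {x = suc x} _ x<n = ∈-map⁺ suc (∈-upTo⁺ x<n)

∈-elems⁻ : ∀ {n x} → x ∈ elems n → x ≤ n
∈-elems⁻ x∈ with y , y∈ , refl ← ∈-map⁻ suc x∈ = ∈-upTo⁻ y∈

∈⇒anyᵇ : ∀ {x xs} → x ∈ xs → T (any (_≡ᵇ x) xs)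
∈⇒anyᵇ {x} x∈ = any⁺ _ (Any.map (λ { refl → ≡⇒≡ᵇ x x refl }) x∈)

-- The interval (a , m] gains the element m + 1 exactly when a < m + 1.
∸-suc : ∀ m a → m ∸ a + [ a <ᵇ suc m ] ≡ suc m ∸ a
∸-suc m zero = +-comm m 1
∸-suc zero (suc a) = sym (0∸n≡0 a)
∸-suc (suc m) (suc a) = ∸-suc m a

-- Adding m + 1 to the ground set adds one element to (a , c + 1) iff a < m + 1 ≤ c.
interval-step : ∀ a c m → (m ⊓ c) ∸ a + [ (a <ᵇ suc m) ∧ (m <ᵇ c) ] ≡ (suc m ⊓ c) ∸ a
interval-step a c m with m <? c
... | yes m<c = begin
  (m ⊓ c) ∸ a + [ (a <ᵇ suc m) ∧ (m <ᵇ c) ]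
    ≡⟨ cong₂ (λ x y → x ∸ a + y) (m≤n⇒m⊓n≡m (<⇒≤ m<c)) ([]-cong (proj₁ ∘ T-∧⁻ (a <ᵇ suc m)) (λ t → T-∧⁺ t (<⇒<ᵇ m<c))) ⟩
  m ∸ a + [ a <ᵇ suc m ]
    ≡⟨ ∸-suc m a ⟩
  suc m ∸ a
    ≡⟨ cong (_∸ a) (sym (m≤n⇒m⊓n≡m m<c)) ⟩
  (suc m ⊓ c) ∸ a ∎
... | no m≮c = begin
  (m ⊓ c) ∸ a + [ (a <ᵇ suc m) ∧ (m <ᵇ c) ]
    ≡⟨ cong ((m ⊓ c) ∸ a +_) ([]-false (m≮c ∘ <ᵇ⇒< m c ∘ proj₂ ∘ T-∧⁻ (a <ᵇ suc m))) ⟩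
  (m ⊓ c) ∸ a + 0
    ≡⟨ +-identityʳ _ ⟩
  (m ⊓ c) ∸ a
    ≡⟨ cong (_∸ a) (trans (m≥n⇒m⊓n≡n c≤m) (sym (m≥n⇒m⊓n≡n (m≤n⇒m≤1+n c≤m)))) ⟩
  (suc m ⊓ c) ∸ a ∎
  where c≤m = ≮⇒≥ m≮c

count-interval : ∀ a c n → ∑ (λ i → [ between a i (suc c) ]) (elems n) ≡ (n ⊓ c) ∸ a
count-interval a c zero = sym (0∸n≡0 a)
count-interval a c (suc m) = begin
  ∑ f (elems (suc m))
    ≡⟨ cong (∑ f) (elems-suc m) ⟩
  ∑ f (elems m ++ suc m ∷ [])
    ≡⟨ ∑-++ f (elems m) _ ⟩
  ∑ f (elems m) + (f (suc m) + 0)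
    ≡⟨ cong₂ _+_ (count-interval a c m) (+-identityʳ (f (suc m))) ⟩
  (m ⊓ c) ∸ a + f (suc m)
    ≡⟨ interval-step a c m ⟩
  (suc m ⊓ c) ∸ a ∎
  where
  f : ℕ → ℕ
  f i = [ between a i (suc c) ]

-- j = s + 1 iff s < j < s + 2, which reduces point counts to interval counts.
≡ᵇ-as-between : ∀ s j → (j ≡ᵇ suc s) ≡ between s j (suc (suc s))
≡ᵇ-as-between s zero = refl
≡ᵇ-as-between zero (suc zero) = refl
≡ᵇ-as-between zero (suc (suc j)) = refl
≡ᵇ-as-between (suc s) (suc j) = ≡ᵇ-as-between s j

count-point : ∀ {n s} → 0 < s → s ≤ n → ∑ (λ j → [ j ≡ᵇ s ]) (elems n) ≡ 1
count-point {n} {suc s} _ s<n = begin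
  ∑ (λ j → [ j ≡ᵇ suc s ]) (elems n)
    ≡⟨ ∑-cong (elems n) (λ {j} _ → cong [_] (≡ᵇ-as-between s j)) ⟩
  ∑ (λ j → [ between s j (suc (suc s)) ]) (elems n)
    ≡⟨ count-interval s (suc s) n ⟩
  (n ⊓ suc s) ∸ s
    ≡⟨ cong (_∸ s) (m≥n⇒m⊓n≡n s<n) ⟩
  suc s ∸ s
    ≡⟨ m+n∸n≡m 1 s ⟩
  1 ∎

leastBelow : {P : ℕ → Set} → Decidable P → ∀ m →
  (∀ k → k ≤ m → ¬ P k) ⊎ ∃[ s ] (s ≤ m × P s × (∀ k → k < s → ¬ P k))
leastBelow P? zero with P? zero
... | yes p0 = inj₂ (zero , z≤n , p0 , λ _ ())
... | no ¬p0 = inj₁ λ { _ z≤n → ¬p0 }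
leastBelow P? (suc m) with leastBelow P? m
... | inj₂ (s , s≤m , ps , first) = inj₂ (s , m≤n⇒m≤1+n s≤m , ps , first)
... | inj₁ none with P? (suc m)
...   | yes p = inj₂ (suc m , ≤-refl , p , λ k k<sm → none k (≤-pred k<sm))
...   | no ¬p = inj₁ below
  where
  below : ∀ k → k ≤ suc m → ¬ _
  below k k≤sm with m≤n⇒m<n∨m≡n k≤sm
  ... | inj₁ k<sm = none k (≤-pred k<sm)
  ... | inj₂ refl = ¬p

≤-maximum : ∀ {x xs} → x ∈ xs → x ≤ foldr _⊔_ 0 xs
≤-maximum {xs = y ∷ ys} (here refl) = m≤m⊔n y _
≤-maximum {xs = y ∷ ys} (there x∈) = ≤-trans (≤-maximum x∈) (m≤n⊔m y _)

maximum-< : ∀ {b xs} → 0 < b → All (_< b) xs → foldr _⊔_ 0 xs < b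
maximum-< 0<b [] = 0<b
maximum-< 0<b (y<b ∷ ys<b) = ⊔-lub y<b (maximum-< 0<b ys<b)

record IsArc (n : ℕ) (L : ℕ → ℕ) (i j : ℕ) : Set where
  field
    ordered : i < j
    sameBlk : L i ≡ L j
    gap : ∀ {k} → k ∈ elems n → i < k → k < j → L i ≢ L k

open IsArc

isArc-sound : ∀ {n L i j} → T (isArc n L i j) → IsArc n L i j
isArc-sound {n} {L} {i} {j} t
  with _ , t₁ ← T-∧⁻ (any (_≡ᵇ i) (elems n)) t
  with _ , t₂ ← T-∧⁻ (any (_≡ᵇ j) (elems n)) t₁
  with i<ᵇj , t₃ ← T-∧⁻ (i <ᵇ j) t₂
  with same , no-between ← T-∧⁻ (L i ≡ᵇ L j) t₃ = record
  { ordered = <ᵇ⇒< i j i<ᵇj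
  ; sameBlk = ≡ᵇ⇒≡ (L i) (L j) same
  ; gap = λ {k} k∈ i<k k<j same-ik →
      T-not⁻ _ (All.lookup (all⁺ _ (elems n) no-between) k∈)
        (T-∧⁺ (between⁺ i<k k<j) (≡⇒≡ᵇ (L i) (L k) same-ik))
  }

isArc-complete : ∀ {n L i j} → i ∈ elems n → j ∈ elems n → IsArc n L i j → T (isArc n L i j)
isArc-complete {n} {L} {i} {j} i∈ j∈ arc =
  T-∧⁺ (∈⇒anyᵇ i∈) (T-∧⁺ (∈⇒anyᵇ j∈) (T-∧⁺ (<⇒<ᵇ (ordered arc))
    (T-∧⁺ (≡⇒≡ᵇ (L i) (L j) (sameBlk arc)) (all⁻ _ (All.tabulate no-between)))))
  where
  no-between : ∀ {k} → k ∈ elems n → T (not (between i k j ∧ sameBlock L i k))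
  no-between {k} k∈ = T-not⁺ λ t →
    let i<k , k<j = between⁻ i k j (proj₁ (T-∧⁻ (between i k j) t))
    in gap arc k∈ i<k k<j (≡ᵇ⇒≡ (L i) (L k) (proj₂ (T-∧⁻ (between i k j) t)))

isBlockMax-sound : ∀ {n L i} → T (isBlockMax n L i) →
  ∀ {k} → k ∈ elems n → i < k → L i ≢ L k
isBlockMax-sound {n} {L} {i} t {k} k∈ i<k same =
  T-not⁻ _ (All.lookup (all⁺ _ (elems n) t) k∈) (T-∧⁺ (<⇒<ᵇ i<k) (≡⇒≡ᵇ (L i) (L k) same))

isBlockMax-complete : ∀ {n L i} → (∀ {k} → k ∈ elems n → i < k → L i ≢ L k) → T (isBlockMax n L i)
isBlockMax-complete {n} {L} {i} none = all⁻ _ (All.tabulate λ {k} k∈ → T-not⁺ λ t →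
  none k∈ (<ᵇ⇒< i k (proj₁ (T-∧⁻ (i <ᵇ k) t))) (≡ᵇ⇒≡ (L i) (L k) (proj₂ (T-∧⁻ (i <ᵇ k) t))))

LaterInBlock : (ℕ → ℕ) → ℕ → ℕ → Set
LaterInBlock L i k = i < k × L i ≡ L k

laterInBlock? : ∀ L i → Decidable (LaterInBlock L i)
laterInBlock? L i k = (i <? k) ×-dec (L i ≟ L k)

arc-to-next : ∀ {n L i j s} → i ∈ elems n → s ∈ elems n → LaterInBlock L i s →
  (∀ k → k < s → ¬ LaterInBlock L i k) → T (isArc n L i j) ⇔ j ≡ s
arc-to-next {n} {L} {i} {j} {s} i∈ s∈ (i<s , same) first = mk⇔ arc⇒next next⇒arc
  where
  arc⇒next : T (isArc n L i j) → j ≡ s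
  arc⇒next t with isArc-sound t | <-cmp j s
  ... | arc | tri< j<s _ _ = ⊥-elim (first j j<s (ordered arc , sameBlk arc))
  ... | _ | tri≈ _ j≡s _ = j≡s
  ... | arc | tri> _ _ s<j = ⊥-elim (gap arc s∈ i<s s<j same)
  next⇒arc : j ≡ s → T (isArc n L i j)
  next⇒arc refl = isArc-complete i∈ s∈ record
    { ordered = i<s ; sameBlk = same ; gap = λ {k} _ i<k k<s → first k k<s ∘ (i<k ,_) }

outgoing-arc : ∀ n L {i} → i ∈ elems n →
  ∑ (λ j → [ isArc n L i j ]) (elems n) + [ isBlockMax n L i ] ≡ 1
outgoing-arc n L {i} i∈ with leastBelow (laterInBlock? L i) n
... | inj₁ none = cong₂ _+_ (∑-zero (elems n) no-arc) ([]-true block-max)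
  where
  no-arc : ∀ {j} → j ∈ elems n → [ isArc n L i j ] ≡ 0
  no-arc {j} j∈ = []-false λ t →
    let arc = isArc-sound {n} {L} {i} {j} t in none j (∈-elems⁻ j∈) (ordered arc , sameBlk arc)
  block-max : T (isBlockMax n L i)
  block-max = isBlockMax-complete λ k∈ i<k same → none _ (∈-elems⁻ k∈) (i<k , same)
... | inj₂ (s , s≤n , later@(i<s , same) , first) = begin
  ∑ (λ j → [ isArc n L i j ]) (elems n) + [ isBlockMax n L i ]
    ≡⟨ cong₂ _+_ (∑-cong (elems n) λ _ → []-cong (≡⇒≡ᵇ _ s ∘ to next) (from next ∘ ≡ᵇ⇒≡ _ s))
                 ([]-false λ t → isBlockMax-sound t s∈ i<s same) ⟩
  ∑ (λ j → [ j ≡ᵇ s ]) (elems n) + 0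
    ≡⟨ +-identityʳ _ ⟩
  ∑ (λ j → [ j ≡ᵇ s ]) (elems n)
    ≡⟨ count-point 0<s s≤n ⟩
  1 ∎
  where
  0<s : 0 < s
  0<s = <-≤-trans z<s i<s
  s∈ : s ∈ elems n
  s∈ = ∈-elems⁺ 0<s s≤n
  next : ∀ {j} → T (isArc n L i j) ⇔ j ≡ s
  next = arc-to-next i∈ s∈ later first

partner<v : ∀ n L {v} → 0 < v → partner n L v < v
partner<v n L {v} 0<v = maximum-< 0<v
  (All.map (λ {k} t → <ᵇ⇒< k v (proj₁ (T-∧⁻ (k <ᵇ v) t)))
           (all-filter (T? ∘ λ k → (k <ᵇ v) ∧ sameBlock L k v) (elems n)))

partner-maximal : ∀ n L {v i} → i ∈ elems n → i < v → L i ≡ L v → i ≤ partner n L v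
partner-maximal n L {v} {i} i∈ i<v same = ≤-maximum
  (∈-filter⁺ (T? ∘ λ k → (k <ᵇ v) ∧ sameBlock L k v) i∈
             (T-∧⁺ (<⇒<ᵇ i<v) (≡⇒≡ᵇ (L i) (L v) same)))

nestedArcsAt : ℕ → (ℕ → ℕ) → ℕ → ℕ → ℕ → ℕ
nestedArcsAt n L u v i = ∑ (λ j → [ isArc n L i j ∧ (between u i j ∧ (j <ᵇ v)) ]) (elems n)

crossingArcsAt : ℕ → (ℕ → ℕ) → ℕ → ℕ → ℕ → ℕ
crossingArcsAt n L u v i = ∑ (λ j → [ isArc n L i j ∧ (between u i v ∧ (v <ᵇ j)) ]) (elems n)

crossingHalfArcAt : ℕ → (ℕ → ℕ) → ℕ → ℕ → ℕ → ℕ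
crossingHalfArcAt n L u v i = [ between u i v ∧ isBlockMax n L i ]

depthIndex-as-sum : ∀ n L v →
  depthIndex n L v ≡ partner n L v + ∑ (nestedArcsAt n L (partner n L v) v) (elems n)
depthIndex-as-sum n L v = cong (partner n L v +_) (count-pairs _ _ (elems n) (elems n))

intertwining-as-sum : ∀ n L v → intertwining n L v
  ≡ ∑ (crossingArcsAt n L (partner n L v) v) (elems n) + ∑ (crossingHalfArcAt n L (partner n L v) v) (elems n)
intertwining-as-sum n L v =
  cong₂ _+_ (count-pairs _ _ (elems n) (elems n)) (length-filterᵇ _ (elems n))

-- A flag a standing for "(i , j) is an arc", where arcs leaving i ∈ (u , v)
-- never end in v: such an arc passes either below v or over v.
split-at-v : ∀ a {u i j v} → u < i → i < v → (T a → i < j × j ≢ v) →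
  [ a ∧ (between u i j ∧ (j <ᵇ v)) ] + [ a ∧ (between u i v ∧ (v <ᵇ j)) ] ≡ [ a ]
split-at-v false _ _ _ = refl
split-at-v true {u} {i} {j} {v} u<i i<v arc with i<j , j≢v ← arc _ = begin
  [ between u i j ∧ (j <ᵇ v) ] + [ between u i v ∧ (v <ᵇ j) ]
    ≡⟨ cong₂ _+_ ([]-∧-true (between u i j) (between⁺ u<i i<j))
                 ([]-∧-true (between u i v) (between⁺ u<i i<v)) ⟩
  [ j <ᵇ v ] + [ v <ᵇ j ]
    ≡⟨ [<]+[>]≡1 j≢v ⟩
  1 ∎

vertex-contribution : ∀ n L {u v} → (∀ {k} → k ∈ elems n → k < v → L k ≡ L v → k ≤ u) →
  ∀ {i} → i ∈ elems n →
  nestedArcsAt n L u v i + (crossingArcsAt n L u v i + crossingHalfArcAt n L u v i) ≡ [ between u i v ]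
vertex-contribution n L {u} {v} dominated {i} i∈ with T? (between u i v)
... | no outside = begin
  nestedArcsAt n L u v i + (crossingArcsAt n L u v i + crossingHalfArcAt n L u v i)
    ≡⟨ cong₂ _+_ (∑-zero (elems n) λ _ → []-false (outside ∘ nested-inside))
         (cong₂ _+_ (∑-zero (elems n) λ _ → []-false (outside ∘ crossing-inside))
                    ([]-false (outside ∘ proj₁ ∘ T-∧⁻ (between u i v)))) ⟩
  0
    ≡⟨ sym ([]-false outside) ⟩
  [ between u i v ] ∎
  where
  nested-inside : ∀ {j} → T (isArc n L i j ∧ (between u i j ∧ (j <ᵇ v))) → T (between u i v)
  nested-inside {j} t with ta , tb ← T-∧⁻ (isArc n L i j) t
                     with tij , j<ᵇv ← T-∧⁻ (between u i j) tb =
    between⁺ (proj₁ (between⁻ u i j tij))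
             (<-trans (ordered (isArc-sound {n} {L} {i} {j} ta)) (<ᵇ⇒< j v j<ᵇv))
  crossing-inside : ∀ {j} → T (isArc n L i j ∧ (between u i v ∧ (v <ᵇ j))) → T (between u i v)
  crossing-inside {j} t = proj₁ (T-∧⁻ (between u i v) (proj₂ (T-∧⁻ (isArc n L i j) t)))
... | yes inside = begin
  nestedArcsAt n L u v i + (crossingArcsAt n L u v i + crossingHalfArcAt n L u v i)
    ≡⟨ sym (+-assoc (nestedArcsAt n L u v i) _ _) ⟩
  nestedArcsAt n L u v i + crossingArcsAt n L u v i + crossingHalfArcAt n L u v i
    ≡⟨ cong₂ _+_ (trans (∑-+ _ _ (elems n)) (∑-cong (elems n) λ {j} _ → split-at-v (isArc n L i j) u<i i<v (arc-avoids-v j)))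
                 ([]-∧-true (between u i v) inside) ⟩
  ∑ (λ j → [ isArc n L i j ]) (elems n) + [ isBlockMax n L i ]
    ≡⟨ outgoing-arc n L i∈ ⟩
  1
    ≡⟨ sym ([]-true inside) ⟩
  [ between u i v ] ∎
  where
  u<i = proj₁ (between⁻ u i v inside)
  i<v = proj₂ (between⁻ u i v inside)
  arc-avoids-v : ∀ j → T (isArc n L i j) → i < j × j ≢ v
  arc-avoids-v j t = ordered arc , λ { refl → <⇒≱ u<i (dominated i∈ i<v (sameBlk arc)) }
    where arc = isArc-sound {n} {L} {i} {j} t

mainTheorem3 : (n : ℕ) (L : ℕ → ℕ) (v : ℕ) → 1 ≤ v → v ≤ n →
    depthIndex n L v + intertwining n L v ≡ v ∸ 1
mainTheorem3 n L (suc c) _ v≤n = begin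
  depthIndex n L v + intertwining n L v
    ≡⟨ cong₂ _+_ (depthIndex-as-sum n L v) (intertwining-as-sum n L v) ⟩
  (u + ∑ N E) + (∑ C E + ∑ H E)
    ≡⟨ +-assoc u (∑ N E) _ ⟩
  u + (∑ N E + (∑ C E + ∑ H E))
    ≡⟨ cong (λ m → u + (∑ N E + m)) (∑-+ C H E) ⟩
  u + (∑ N E + ∑ (λ i → C i + H i) E)
    ≡⟨ cong (u +_) (∑-+ N _ E) ⟩
  u + ∑ (λ i → N i + (C i + H i)) E
    ≡⟨ cong (u +_) (∑-cong E (vertex-contribution n L (partner-maximal n L))) ⟩
  u + ∑ (λ i → [ between u i v ]) E
    ≡⟨ cong (u +_) (count-interval u c n) ⟩
  u + ((n ⊓ c) ∸ u)
    ≡⟨ cong (λ m → u + (m ∸ u)) (m≥n⇒m⊓n≡n (≤-trans (n≤1+n c) v≤n)) ⟩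
  u + (c ∸ u)
    ≡⟨ m+[n∸m]≡n (≤-pred (partner<v n L z<s)) ⟩
  c ∎
  where
  v = suc c
  u = partner n L v
  E = elems n
  N C H : ℕ → ℕ
  N = nestedArcsAt n L u v
  C = crossingArcsAt n L u v
  H = crossingHalfArcAt n L u v
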